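{- Let $G$ be a finite connected simple graph with an articulation point $u$, let $H_1,\ldots,H_k$ be the connected components of $G-u$, and let $G_i$ be the subgraph of $G$ induced by $V(H_i)\cup\{u\}$ for $i=1,\ldots,k$. Then, for \textsc{Closed Geodetic Game}, $$\mathcal{G}(G,\{u\})=\mathcal{G}(G_1,\{u\})\oplus\cdots\oplus\mathcal{G}(G_k,\{u\}).$$
   Context: For vertices $x,y$ of a graph, $\mathcal{I}(x,y)$ is the set of vertices on some shortest $x$–$y$ path ($\mathcal{I}(x,x)=\{x\}$); for a vertex set $S$, the geodetic closure is $(S)=\bigcup_{x,y\in S}\mathcal{I}(x,y)$. \textsc{Closed Geodetic Game} on a graph $H$ from a position $H,S$ (meaning the vertices of $S$ are already selected): two players alternately add to $S$ a vertex of $H$ not in the current closure $(S)$; when $(S)=V(H)$ there is no legal move and the game ends; the player making the last move wins. The options of a position are the positions reachable by one legal move. The Sprague–Grundy value $\mathcal{G}(P)$ of a position $P$ is defined recursively as $\mathcal{G}(P)=\operatorname{mex}\{\mathcal{G}(P'):P'\text{ an option of }P\}$, where $\operatorname{mex}(X)$ is the smallest nonnegative integer not in $X$ (so a position with no options has value $0$). $\oplus$ denotes bitwise XOR of nonnegative integers. -}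

module Defs where

open import Data.Nat using (ℕ; zero; suc; _+_; _*_; _≤_; _<_)
open import Data.Nat.DivMod using (_/_; _%_)
open import Data.Bool using (Bool; true; false; _∨_; _xor_)
open import Data.Fin using (Fin; _≟_)
import Data.Fin as F
open import Data.Fin.Subset using (Subset; _∈_; _∪_; ⁅_⁆; ∁; ⊤)
open import Data.Vec using (tabulate)
open import Data.Product using (Σ; _×_; ∃; ∃-syntax)
open import Relation.Nullary using (¬_; does)
open import Relation.Binary.PropositionalEquality using (_≡_; _≢_)

record SimpleGraph (n : ℕ) : Set where
  field
    adj    : Fin n → Fin n → Bool
    sym    : ∀ x y → adj x y ≡ adj y x
    irrefl : ∀ x → adj x x ≡ false
open SimpleGraph public

module _ {n : ℕ} (G : SimpleGraph n) (W : Subset n) where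

  data Walk : Fin n → Fin n → ℕ → Set where
    here : ∀ {x} → x ∈ W → Walk x x 0
    step : ∀ {x y z l} → x ∈ W → adj G x y ≡ true → Walk y z l → Walk x z (suc l)

  data Visits (v : Fin n) : ∀ {x z l} → Walk x z l → Set where
    visits-here : ∀ {x} {p : x ∈ W} → v ≡ x → Visits v (here p)
    visits-start : ∀ {x y z l} {p : x ∈ W} {e : adj G x y ≡ true} {w : Walk y z l} →
                   v ≡ x → Visits v (step p e w)
    visits-later : ∀ {x y z l} {p : x ∈ W} {e : adj G x y ≡ true} {w : Walk y z l} →
                   Visits v w → Visits v (step p e w)

  IsDist : Fin n → Fin n → ℕ → Set
  IsDist x y d = Walk x y d × (∀ l → Walk x y l → d ≤ l)

  InInterval : Fin n → Fin n → Fin n → Set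
  InInterval x y z = ∃[ d ] (IsDist x y d × Σ (Walk x y d) λ w → Visits z w)

  InClosure : Subset n → Fin n → Set
  InClosure S z = ∃[ x ] ∃[ y ] (x ∈ S × y ∈ S × InInterval x y z)

  Legal : Subset n → Fin n → Set
  Legal S v = v ∈ W × ¬ InClosure S v

  -- Grundy S g : the Sprague–Grundy value of position (graph, S) is g,
  -- i.e. g = mex { values of options }: g is not the value of any option,
  -- and every m < g is the value of some option.
  data Grundy : Subset n → ℕ → Set where
    grundy : ∀ {S g} →
      (∀ v → Legal S v → Σ ℕ λ g' → Grundy (S ∪ ⁅ v ⁆) g' × g' ≢ g) →
      (∀ m → m < g → Σ (Fin n) λ v → Legal S v × Grundy (S ∪ ⁅ v ⁆) m) →
      Grundy S g

-- bitwise XOR on ℕ (fuel-bounded binary recursion; fuel a + b suffices)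
xorF : ℕ → ℕ → ℕ → ℕ
xorF zero a b = 0
xorF (suc f) a b = bit ((a % 2) , (b % 2)) + 2 * xorF f (a / 2) (b / 2)
  where
  open import Data.Product using (_,_)
  bit : ℕ × ℕ → ℕ
  bit (0 , 1) = 1
  bit (1 , 0) = 1
  bit _ = 0

_⊕_ : ℕ → ℕ → ℕ
a ⊕ b = xorF (a + b) a b

bigXor : ∀ {k} → (Fin k → ℕ) → ℕ
bigXor {zero} g = 0
bigXor {suc k} g = g F.zero ⊕ bigXor (λ i → g (F.suc i))

Connected : ∀ {n} → SimpleGraph n → Set
Connected {n} G = ∀ (x y : Fin n) → ∃[ l ] Walk G ⊤ x y l

ReachAvoiding : ∀ {n} → SimpleGraph n → Fin n → Fin n → Fin n → Set
ReachAvoiding G u x y = ∃[ l ] Walk G (∁ ⁅ u ⁆) x y l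

Articulation : ∀ {n} → SimpleGraph n → Fin n → Set
Articulation G u = ∃[ x ] ∃[ y ] (x ≢ u × y ≢ u × ¬ ReachAvoiding G u x y)

-- c labels the connected components H₁,…,H_k of G − u by Fin k:
-- two vertices ≠ u get the same label iff they are connected in G − u,
-- and every label is used. (c u is irrelevant.)
IsComponentLabeling : ∀ {n k} → SimpleGraph n → Fin n → (Fin n → Fin k) → Set
IsComponentLabeling {n} {k} G u c =
  (∀ x y → x ≢ u → y ≢ u →
     (c x ≡ c y → ReachAvoiding G u x y) × (ReachAvoiding G u x y → c x ≡ c y)) ×
  (∀ (i : Fin k) → ∃[ x ] (x ≢ u × c x ≡ i))

compVerts : ∀ {n k} → Fin n → (Fin n → Fin k) → Fin k → Subset n
compVerts u c i = tabulate (λ x → does (x ≟ u) ∨ does (c x F.≟ i))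

{-# OPTIONS --safe #-}
-- Once u is selected, the game on G splits into the games on the blocks G_i. A walk between two
-- vertices of G_i can leave G_i only through u and must come back through u, so it can be shortened
-- inside G_i: geodesics of G_i are geodesics of G. Conversely, a geodesic of G through v ∈ H_i, cut
-- where it last enters and first leaves G_i, is a geodesic of G_i through v whose ends are selected
-- (they are the old ends or u). Hence a vertex is legal in G iff it is legal in its own block, and
-- playing it leaves the other blocks untouched: the game is the disjunctive sum of the block games.
-- Its Grundy value is then the nim-sum, because changing one summand changes a nim-sum, and every
-- smaller value is reached by lowering a single summand.
module Submission where

open import Defs hiding (sym)
open import Data.Bool using (Bool; true; false; _xor_; _∨_)
import Data.Bool.Properties as Bool
open import Data.Bool.Properties using (xor-assoc; xor-comm; xor-same; xor-identityʳ)
open import Data.Fin using (Fin; zero; suc; _≟_; toℕ; fromℕ; fromℕ<)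
open import Data.Fin.Properties using (any?; all?; injective⇒≤; toℕ<n; ¬∀⟶∃¬-smallest; toℕ-fromℕ; toℕ-fromℕ<; toℕ-inject)
open import Data.Fin.Subset using (Subset; _∈_; _∉_; _∪_; ⁅_⁆; _⊂_; _⊆_; ⊤; ∁)
open import Data.Fin.Subset.Induction using (⊃-wellFounded)
open import Data.Fin.Subset.Properties using (_∈?_; p⊆p∪q; x∈p∪q⁺; x∈p∪q⁻; x∈⁅x⁆; x∈⁅y⁆⇒x≡y; x∉p⇒x∈∁p; ∈⊤)
open import Induction.WellFounded using (module All)
open import Level using (0ℓ)
open import Data.Nat using (ℕ; zero; suc; _+_; _*_; _≤_; _<_; z≤n; s≤s; s≤s⁻¹)
import Data.Nat as ℕ
open import Data.Nat.Divisibility using (m∣m*n)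
open import Data.Nat.DivMod using (_/_; _%_; [m+kn]%n≡m%n; +-distrib-/-∣ʳ; /-congˡ; m*n/n≡m)
open import Data.Nat.Properties hiding (_≟_)
open import Data.Product using (Σ; ∃; ∃-syntax; _×_; _,_; proj₁; proj₂)
open import Data.Sum using (_⊎_; inj₁; inj₂; [_,_]′)
open import Data.Vec.Functional using (updateAt)
open import Data.Vec.Functional.Properties using (updateAt-updates; updateAt-minimal)
open import Data.Vec.Properties using (lookup∘tabulate; lookup⇒[]=; []=⇒lookup)
open import Function using (const; id; _∘_)
open import Relation.Binary.Definitions using (tri<; tri≈; tri>)
open import Relation.Binary.PropositionalEquality
open import Relation.Nullary using (¬_; Dec; yes; no; does; contradiction)
open import Relation.Nullary.Decidable using (map′; _×-dec_; _⊎-dec_; ¬?; dec-true)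
open import Relation.Unary using (Decidable)

-- Nim sums

bit : Bool → ℕ
bit false = 0
bit true  = 1

data Binary : ℕ → Set where
  bin : (r : Bool) (q : ℕ) → Binary (bit r + 2 * q)

binary : ∀ a → Binary a
binary zero = bin false 0
binary (suc a) with binary a
... | bin false q = bin true q
... | bin true  q = subst Binary (cong suc (+-suc q (q + 0))) (bin false (suc q))

bit-%2 : ∀ r q → (bit r + 2 * q) % 2 ≡ bit r
bit-%2 r q = begin
  (bit r + 2 * q) % 2 ≡⟨ cong (λ t → (bit r + t) % 2) (*-comm 2 q) ⟩
  (bit r + q * 2) % 2 ≡⟨ [m+kn]%n≡m%n (bit r) q 2 ⟩
  bit r % 2           ≡⟨ bit%2 r ⟩
  bit r               ∎
  where
  open ≡-Reasoning
  bit%2 : ∀ r → bit r % 2 ≡ bit r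
  bit%2 false = refl
  bit%2 true  = refl

bit-/2 : ∀ r q → (bit r + 2 * q) / 2 ≡ q
bit-/2 r q = begin
  (bit r + 2 * q) / 2   ≡⟨ +-distrib-/-∣ʳ (bit r) (m∣m*n q) ⟩
  bit r / 2 + 2 * q / 2 ≡⟨ cong₂ _+_ (bit/2 r) (/-congˡ (*-comm 2 q)) ⟩
  q * 2 / 2             ≡⟨ m*n/n≡m q 2 ⟩
  q                     ∎
  where
  open ≡-Reasoning
  bit/2 : ∀ r → bit r / 2 ≡ 0
  bit/2 false = refl
  bit/2 true  = refl

bit-injective : ∀ {r s} → bit r ≡ bit s → r ≡ s
bit-injective {false} {false} _ = refl
bit-injective {true}  {true}  _ = refl

bin-injective : ∀ r s {p q} → bit r + 2 * p ≡ bit s + 2 * q → r ≡ s × p ≡ q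
bin-injective r s {p} {q} eq =
  r≡s , *-cancelˡ-≡ p q 2 (+-cancelˡ-≡ (bit s) _ _ (subst (λ t → bit t + 2 * p ≡ _) r≡s eq))
  where
  r≡s : r ≡ s
  r≡s = bit-injective (trans (sym (bit-%2 r p)) (trans (cong (_% 2) eq) (bit-%2 s q)))

halve-≤ : ∀ r q {F} → bit r + 2 * q ≤ suc F → q ≤ F
halve-≤ r zero    _ = z≤n
halve-≤ r (suc q) {F} h = s≤s⁻¹ (begin-strict
  suc q             <⟨ m<m*n (suc q) 2 ≤-refl ⟩
  suc q * 2         ≡⟨ *-comm (suc q) 2 ⟩
  2 * suc q         ≤⟨ m≤n+m _ (bit r) ⟩
  bit r + 2 * suc q ≤⟨ h ⟩
  suc F             ∎)
  where open ≤-Reasoning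

bin-<-mono : ∀ r s {p q} → p < q → bit r + 2 * p < bit s + 2 * q
bin-<-mono r s {p} {q} p<q = begin-strict
  bit r + 2 * p ≤⟨ +-monoˡ-≤ (2 * p) (bit≤1 r) ⟩
  1 + 2 * p     <⟨ n<1+n _ ⟩
  2 + 2 * p     ≡⟨ *-distribˡ-+ 2 1 p ⟨
  2 * suc p     ≤⟨ *-monoʳ-≤ 2 p<q ⟩
  2 * q         ≤⟨ m≤n+m _ (bit s) ⟩
  bit s + 2 * q ∎
  where
  open ≤-Reasoning
  bit≤1 : ∀ r → bit r ≤ 1
  bit≤1 false = z≤n
  bit≤1 true  = s≤s z≤n

bin-<-split : ∀ r s p q → bit r + 2 * p < bit s + 2 * q → p < q ⊎ (p ≡ q × r ≡ false × s ≡ true)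
bin-<-split r s p q lt with <-cmp p q
... | tri< p<q _ _ = inj₁ p<q
... | tri> _ _ q<p = contradiction lt (<-asym (bin-<-mono s r q<p))
... | tri≈ _ refl _ = inj₂ (refl , bits-< r s (+-cancelʳ-< _ (bit r) (bit s) lt))
  where
  bits-< : ∀ r s → bit r < bit s → r ≡ false × s ≡ true
  bits-< false true _ = refl , refl
  bits-< true  true (s≤s ())

xor-cancelʳ : ∀ r s → (r xor s) xor s ≡ r
xor-cancelʳ r s = trans (xor-assoc r s s) (trans (cong (r xor_) (xor-same s)) (xor-identityʳ r))

xorF-0-0 : ∀ f → xorF f 0 0 ≡ 0
xorF-0-0 zero    = refl
xorF-0-0 (suc f) = cong (2 *_) (xorF-0-0 f)

xorF-bin : ∀ f r s a b → xorF (suc f) (bit r + 2 * a) (bit s + 2 * b) ≡ bit (r xor s) + 2 * xorF f a b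
xorF-bin f r s a b rewrite bit-%2 r a | bit-%2 s b | bit-/2 r a | bit-/2 s b with r | s
... | false | false = refl
... | false | true  = refl
... | true  | false = refl
... | true  | true  = refl

xorF-fuel : ∀ {f g} a b → a + b ≤ f → a + b ≤ g → xorF f a b ≡ xorF g a b
xorF-fuel {zero}  {g}     zero zero _ _ = sym (xorF-0-0 g)
xorF-fuel {suc f} {zero}  zero zero _ _ = xorF-0-0 (suc f)
xorF-fuel {suc f} {suc g} a b a+b≤f a+b≤g with binary a | binary b
... | bin r a′ | bin s b′ = begin
  xorF (suc f) (bit r + 2 * a′) (bit s + 2 * b′) ≡⟨ xorF-bin f r s a′ b′ ⟩
  bit (r xor s) + 2 * xorF f a′ b′              ≡⟨ cong (λ t → bit (r xor s) + 2 * t)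
                                                        (xorF-fuel a′ b′ (halve a+b≤f) (halve a+b≤g)) ⟩
  bit (r xor s) + 2 * xorF g a′ b′              ≡⟨ sym (xorF-bin g r s a′ b′) ⟩
  xorF (suc g) (bit r + 2 * a′) (bit s + 2 * b′) ∎
  where
  open ≡-Reasoning
  halve : ∀ {F} → bit r + 2 * a′ + (bit s + 2 * b′) ≤ suc F → a′ + b′ ≤ F
  halve h = halve-≤ false (a′ + b′) (≤-trans 2[a′+b′]≤ h)
    where
    2[a′+b′]≤ : 2 * (a′ + b′) ≤ bit r + 2 * a′ + (bit s + 2 * b′)
    2[a′+b′]≤ = ≤-trans (≤-reflexive (*-distribˡ-+ 2 a′ b′))
                        (+-mono-≤ (m≤n+m _ (bit r)) (m≤n+m _ (bit s)))

⊕-bin : ∀ r s a b → (bit r + 2 * a) ⊕ (bit s + 2 * b) ≡ bit (r xor s) + 2 * (a ⊕ b)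
⊕-bin r s a b = begin
  xorF (A + B) A B                     ≡⟨ xorF-fuel A B ≤-refl (n≤1+n _) ⟩
  xorF (suc (A + B)) A B               ≡⟨ xorF-bin (A + B) r s a b ⟩
  bit (r xor s) + 2 * xorF (A + B) a b ≡⟨ cong (λ t → bit (r xor s) + 2 * t)
                                               (xorF-fuel a b a+b≤A+B ≤-refl) ⟩
  bit (r xor s) + 2 * (a ⊕ b)          ∎
  where
  open ≡-Reasoning
  A B : ℕ
  A = bit r + 2 * a
  B = bit s + 2 * b
  ≤bin : ∀ t x → x ≤ bit t + 2 * x
  ≤bin t x = ≤-trans (m≤n*m x 2) (m≤n+m _ (bit t))
  a+b≤A+B : a + b ≤ A + B
  a+b≤A+B = +-mono-≤ (≤bin r a) (≤bin s b)

xorF-comm : ∀ f a b → xorF f a b ≡ xorF f b a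
xorF-comm zero    a b = refl
xorF-comm (suc f) a b with binary a | binary b
... | bin r a′ | bin s b′ = begin
  xorF (suc f) (bit r + 2 * a′) (bit s + 2 * b′) ≡⟨ xorF-bin f r s a′ b′ ⟩
  bit (r xor s) + 2 * xorF f a′ b′              ≡⟨ cong₂ (λ t x → bit t + 2 * x)
                                                         (xor-comm r s) (xorF-comm f a′ b′) ⟩
  bit (s xor r) + 2 * xorF f b′ a′              ≡⟨ xorF-bin f s r b′ a′ ⟨
  xorF (suc f) (bit s + 2 * b′) (bit r + 2 * a′) ∎
  where open ≡-Reasoning

⊕-comm : ∀ a b → a ⊕ b ≡ b ⊕ a
⊕-comm a b = trans (xorF-comm (a + b) a b) (cong (λ f → xorF f b a) (+-comm a b))

⊕-cancelʳ-≤ : ∀ {F} a a′ b → a ≤ F → a′ ≤ F → b ≤ F → a ⊕ b ≡ a′ ⊕ b → a ≡ a′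
⊕-cancelʳ-≤ {zero} zero zero _ _ _ _ _ = refl
⊕-cancelʳ-≤ {suc F} a a′ b a≤ a′≤ b≤ eq with binary a | binary a′ | binary b
... | bin r p | bin r′ p′ | bin s q
  with bin-injective (r xor s) (r′ xor s) (trans (sym (⊕-bin r s p q)) (trans eq (⊕-bin r′ s p′ q)))
... | r⊕s≡r′⊕s , p⊕q≡p′⊕q =
  cong₂ (λ t x → bit t + 2 * x)
    (trans (sym (xor-cancelʳ r s)) (trans (cong (_xor s) r⊕s≡r′⊕s) (xor-cancelʳ r′ s)))
    (⊕-cancelʳ-≤ p p′ q (halve-≤ r p a≤) (halve-≤ r′ p′ a′≤) (halve-≤ s q b≤) p⊕q≡p′⊕q)

⊕-cancelʳ : ∀ a a′ b → a ⊕ b ≡ a′ ⊕ b → a ≡ a′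
⊕-cancelʳ a a′ b = ⊕-cancelʳ-≤ a a′ b
  (≤-trans (m≤m+n a a′) (m≤m+n _ b)) (≤-trans (m≤n+m a′ a) (m≤m+n _ b)) (m≤n+m b _)

⊕-cancelˡ : ∀ a b b′ → a ⊕ b ≡ a ⊕ b′ → b ≡ b′
⊕-cancelˡ a b b′ eq = ⊕-cancelʳ b b′ a (trans (⊕-comm b a) (trans eq (⊕-comm a b′)))

LowerOneSummand : ℕ → ℕ → ℕ → Set
LowerOneSummand m a b = (∃[ a′ ] a′ < a × a′ ⊕ b ≡ m) ⊎ (∃[ b′ ] b′ < b × a ⊕ b′ ≡ m)

⊕-decrease-≤ : ∀ {F} m a b → m ≤ F → a ≤ F → b ≤ F → m < a ⊕ b → LowerOneSummand m a b
⊕-decrease-≤ {zero} m zero zero _ _ _ ()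
⊕-decrease-≤ {suc F} m a b m≤ a≤ b≤ m<a⊕b with binary m | binary a | binary b
... | bin t m′ | bin r a′ | bin s b′
  with bin-<-split t (r xor s) m′ (a′ ⊕ b′) (subst (bit t + 2 * m′ <_) (⊕-bin r s a′ b′) m<a⊕b)
... | inj₁ m′<a′⊕b′
  with ⊕-decrease-≤ m′ a′ b′ (halve-≤ t m′ m≤) (halve-≤ r a′ a≤) (halve-≤ s b′ b≤) m′<a′⊕b′
...   | inj₁ (a″ , a″<a′ , a″⊕b′≡m′) =
  inj₁ (bit (t xor s) + 2 * a″ , bin-<-mono (t xor s) r a″<a′ ,
        trans (⊕-bin (t xor s) s a″ b′) (cong₂ (λ x y → bit x + 2 * y) (xor-cancelʳ t s) a″⊕b′≡m′))
...   | inj₂ (b″ , b″<b′ , a′⊕b″≡m′) =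
  inj₂ (bit (t xor r) + 2 * b″ , bin-<-mono (t xor r) s b″<b′ ,
        trans (⊕-bin r (t xor r) a′ b″)
              (cong₂ (λ x y → bit x + 2 * y) (trans (xor-comm r _) (xor-cancelʳ t r)) a′⊕b″≡m′))
⊕-decrease-≤ {suc F} _ _ _ _ _ _ _ | bin false m′ | bin true a′ | bin false b′ | inj₂ (refl , refl , refl) =
  inj₁ (2 * a′ , ≤-refl , ⊕-bin false false a′ b′)
⊕-decrease-≤ {suc F} _ _ _ _ _ _ _ | bin false m′ | bin false a′ | bin true b′ | inj₂ (refl , refl , refl) =
  inj₂ (2 * b′ , ≤-refl , ⊕-bin false false a′ b′)

⊕-decrease : ∀ m a b → m < a ⊕ b → LowerOneSummand m a b
⊕-decrease m a b = ⊕-decrease-≤ m a b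
  (≤-trans (m≤m+n m a) (m≤m+n _ b)) (≤-trans (m≤n+m a m) (m≤m+n _ b)) (m≤n+m b _)

_[_]≔_ : ∀ {k} → (Fin k → ℕ) → Fin k → ℕ → Fin k → ℕ
gs [ j ]≔ a = updateAt gs j (const a)

bigXor-update-cancel : ∀ {k} (gs : Fin k → ℕ) j a → bigXor (gs [ j ]≔ a) ≡ bigXor gs → a ≡ gs j
bigXor-update-cancel gs zero    a eq = ⊕-cancelʳ a (gs zero) _ eq
bigXor-update-cancel gs (suc j) a eq =
  bigXor-update-cancel (λ i → gs (suc i)) j a (⊕-cancelˡ (gs zero) _ _ eq)

bigXor-decrease : ∀ {k} (gs : Fin k → ℕ) m → m < bigXor gs →
                  ∃[ j ] ∃[ a ] a < gs j × bigXor (gs [ j ]≔ a) ≡ m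
bigXor-decrease {suc k} gs m m<⊕ with ⊕-decrease m (gs zero) (bigXor (λ i → gs (suc i))) m<⊕
... | inj₁ (a , a<g₀ , eq) = zero , a , a<g₀ , eq
... | inj₂ (b , b<⊕ , eq) with bigXor-decrease (λ i → gs (suc i)) b b<⊕
...   | j , a , a<gⱼ , eq′ = suc j , a , a<gⱼ , trans (cong (gs zero ⊕_) eq′) eq

-- Walks and geodesics

module _ {n} {G : SimpleGraph n} where

  walk-start-∈ : ∀ {W x y l} → Walk G W x y l → x ∈ W
  walk-start-∈ (here x∈W)     = x∈W
  walk-start-∈ (step x∈W _ _) = x∈W

  walk-end-∈ : ∀ {W x y l} → Walk G W x y l → y ∈ W
  walk-end-∈ (here y∈W)   = y∈W
  walk-end-∈ (step _ _ w) = walk-end-∈ w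

  weaken : ∀ {W W′ x y l} → W ⊆ W′ → Walk G W x y l → Walk G W′ x y l
  weaken W⊆W′ (here x∈W)     = here (W⊆W′ x∈W)
  weaken W⊆W′ (step x∈W e w) = step (W⊆W′ x∈W) e (weaken W⊆W′ w)

  visits-weaken : ∀ {W W′ v x y l} (W⊆W′ : W ⊆ W′) (w : Walk G W x y l) →
                  Visits G W v w → Visits G W′ v (weaken W⊆W′ w)
  visits-weaken _ (here _)         (visits-here v≡x)  = visits-here v≡x
  visits-weaken _ (step _ _ _)     (visits-start v≡x) = visits-start v≡x
  visits-weaken W⊆W′ (step _ _ w) (visits-later on)  = visits-later (visits-weaken W⊆W′ w on)

  infixr 5 _++ʷ_
  _++ʷ_ : ∀ {W x y z l₁ l₂} → Walk G W x y l₁ → Walk G W y z l₂ → Walk G W x z (l₁ + l₂)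
  here _       ++ʷ w′ = w′
  step x∈W e w ++ʷ w′ = step x∈W e (w ++ʷ w′)

  visits-first : ∀ {W x y l} (w : Walk G W x y l) → Visits G W x w
  visits-first (here _)     = visits-here refl
  visits-first (step _ _ _) = visits-start refl

  visits-++ʳ : ∀ {W v x y z l₁ l₂} (w : Walk G W x y l₁) {w′ : Walk G W y z l₂} →
               Visits G W v w′ → Visits G W v (w ++ʷ w′)
  visits-++ʳ (here _)     on = on
  visits-++ʳ (step _ _ w) on = visits-later (visits-++ʳ w on)

  split-at : ∀ {W v x y l} (w : Walk G W x y l) → Visits G W v w →
             ∃ λ l₁ → ∃ λ l₂ → Walk G W x v l₁ × Walk G W v y l₂ × l₁ + l₂ ≡ l
  split-at w@(here x∈W)     (visits-here refl)  = 0 , 0 , w , w , refl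
  split-at w@(step x∈W _ _) (visits-start refl) = 0 , _ , here x∈W , w , refl
  split-at (step x∈W e w)   (visits-later on) with split-at w on
  ... | l₁ , l₂ , w₁ , w₂ , l₁+l₂≡l = suc l₁ , l₂ , step x∈W e w₁ , w₂ , cong suc l₁+l₂≡l

module Geodesics {n} (G : SimpleGraph n) (W : Subset n) where

  data IsPath : ∀ {x y l} → Walk G W x y l → Set where
    path-here : ∀ {x} {x∈W : x ∈ W} → IsPath (here x∈W)
    path-step : ∀ {x y z l} {x∈W : x ∈ W} {e : adj G x y ≡ true} {w : Walk G W y z l} →
                ¬ Visits G W x w → IsPath w → IsPath (step x∈W e w)

  visits? : ∀ v {x y l} (w : Walk G W x y l) → Dec (Visits G W v w)
  visits? v (here {x} _) = map′ visits-here (λ { (visits-here v≡x) → v≡x }) (v ≟ x)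
  visits? v (step {x} _ _ w) =
    map′ [ visits-start , visits-later ]′ (λ { (visits-start v≡x) → inj₁ v≡x ; (visits-later on) → inj₂ on })
         (v ≟ x ⊎-dec visits? v w)

  path-suffix : ∀ {v x y l} (w : Walk G W x y l) → IsPath w → Visits G W v w →
                ∃ λ l′ → l′ ≤ l × Σ (Walk G W v y l′) IsPath
  path-suffix w@(here _)   p (visits-here refl)  = _ , ≤-refl , w , p
  path-suffix w@(step _ _ _) p (visits-start refl) = _ , ≤-refl , w , p
  path-suffix (step _ _ w) (path-step _ p) (visits-later on) with path-suffix w p on
  ... | l′ , l′≤l , w′ , p′ = l′ , m≤n⇒m≤1+n l′≤l , w′ , p′

  walk⇒path : ∀ {x y l} → Walk G W x y l → ∃ λ l′ → l′ ≤ l × Σ (Walk G W x y l′) IsPath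
  walk⇒path w@(here _) = _ , ≤-refl , w , path-here
  walk⇒path {x} (step x∈W e w) with walk⇒path w
  ... | l′ , l′≤l , w′ , p with visits? x w′
  ...   | no ¬on = suc l′ , s≤s l′≤l , step x∈W e w′ , path-step ¬on p
  ...   | yes on with path-suffix w′ p on
  ...     | l″ , l″≤l′ , w″ , p″ = l″ , m≤n⇒m≤1+n (≤-trans l″≤l′ l′≤l) , w″ , p″

  vertex : ∀ {x y l} → Walk G W x y l → Fin (suc l) → Fin n
  vertex (here {x} _)     zero    = x
  vertex (step {x} _ _ _) zero    = x
  vertex (step _ _ w)     (suc i) = vertex w i

  visits-vertex : ∀ {x y l} (w : Walk G W x y l) i → Visits G W (vertex w i) w
  visits-vertex (here _)     zero    = visits-here refl
  visits-vertex (step _ _ _) zero    = visits-start refl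
  visits-vertex (step _ _ w) (suc i) = visits-later (visits-vertex w i)

  vertex-injective : ∀ {x y l} (w : Walk G W x y l) → IsPath w → ∀ {i j} → vertex w i ≡ vertex w j → i ≡ j
  vertex-injective (here _)     _                 {zero}  {zero}  _     = refl
  vertex-injective (step _ _ _) _                 {zero}  {zero}  _     = refl
  vertex-injective (step _ _ w) (path-step ¬on _) {zero}  {suc j} x≡wⱼ =
    contradiction (subst (λ v → Visits G W v w) (sym x≡wⱼ) (visits-vertex w j)) ¬on
  vertex-injective (step _ _ w) (path-step ¬on _) {suc i} {zero}  wᵢ≡x =
    contradiction (subst (λ v → Visits G W v w) wᵢ≡x (visits-vertex w i)) ¬on
  vertex-injective (step _ _ w) (path-step _ p)   {suc i} {suc j} wᵢ≡wⱼ =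
    cong suc (vertex-injective w p wᵢ≡wⱼ)

  path-length<n : ∀ {x y l} (w : Walk G W x y l) → IsPath w → l < n
  path-length<n w p = injective⇒≤ (vertex-injective w p)

  dist<n : ∀ {x y d} → IsDist G W x y d → d < n
  dist<n (w , min) with walk⇒path w
  ... | l′ , _ , w′ , p = ≤-<-trans (min l′ w′) (path-length<n w′ p)

  walk? : ∀ x y l → Dec (Walk G W x y l)
  walk? x y zero =
    map′ (λ { (refl , x∈W) → here x∈W }) (λ { (here x∈W) → refl , x∈W })
         ((x ≟ y) ×-dec (x ∈? W))
  walk? x y (suc l) =
    map′ (λ (x∈W , z , e , w) → step x∈W e w) (λ { (step x∈W e w) → x∈W , _ , e , w })
         ((x ∈? W) ×-dec any? λ z → (adj G x z Bool.≟ true) ×-dec walk? z y l)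

  walk-visiting? : ∀ v x y l → Dec (Σ (Walk G W x y l) (Visits G W v))
  walk-visiting? v x y zero =
    map′ (λ { (refl , x∈W , v≡x) → here x∈W , visits-here v≡x })
         (λ { (here x∈W , visits-here v≡x) → refl , x∈W , v≡x })
         ((x ≟ y) ×-dec (x ∈? W) ×-dec (v ≟ x))
  walk-visiting? v x y (suc l) =
    map′ (λ { (x∈W , z , e , inj₁ (v≡x , w)) → step x∈W e w , visits-start v≡x
            ; (x∈W , z , e , inj₂ (w , on)) → step x∈W e w , visits-later on })
         (λ { (step x∈W e w , visits-start v≡x) → x∈W , _ , e , inj₁ (v≡x , w)
            ; (step x∈W e w , visits-later on) → x∈W , _ , e , inj₂ (w , on) })
         ((x ∈? W) ×-dec any? λ z → (adj G x z Bool.≟ true) ×-dec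
                                     ((v ≟ x ×-dec walk? z y l) ⊎-dec walk-visiting? v z y l))

  isDist? : ∀ x y d → Dec (IsDist G W x y d)
  isDist? x y d =
    map′ (λ (w , none) → w , λ l w′ → ≮⇒≥ λ l<d → none (fromℕ< l<d) (subst (Walk G W x y) (sym (toℕ-fromℕ< l<d)) w′))
         (λ (w , min) → w , λ i w′ → <⇒≱ (toℕ<n i) (min _ w′))
         (walk? x y d ×-dec all? λ (i : Fin d) → ¬? (walk? x y (toℕ i)))

  inInterval? : ∀ x y z → Dec (InInterval G W x y z)
  inInterval? x y z =
    map′ (λ (d , dist , on) → toℕ d , dist , on)
         (λ (d , dist , on) → fromℕ< (dist<n dist) ,
            subst (λ d → IsDist G W x y d × Σ (Walk G W x y d) (Visits G W z)) (sym (toℕ-fromℕ< (dist<n dist))) (dist , on))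
         (any? λ (d : Fin n) → isDist? x y (toℕ d) ×-dec walk-visiting? z x y (toℕ d))

  inClosure? : ∀ S z → Dec (InClosure G W S z)
  inClosure? S z = any? λ x → any? λ y → (x ∈? S) ×-dec (y ∈? S) ×-dec inInterval? x y z

  legal? : ∀ S v → Dec (Legal G W S v)
  legal? S v = (v ∈? W) ×-dec ¬? (inClosure? S v)

open Geodesics

-- Sprague–Grundy values

least-failure : ∀ {P : ℕ → Set} → Decidable P → ∀ {N} → ¬ P N →
                ∃ λ g → ¬ P g × (∀ {m} → m < g → P m)
least-failure {P} P? {N} ¬PN
  with ¬∀⟶∃¬-smallest (suc N) (P ∘ toℕ) (P? ∘ toℕ) (λ ∀P → ¬PN (subst P (toℕ-fromℕ N) (∀P (fromℕ N))))
... | i , ¬Pi , below =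
  toℕ i , ¬Pi , λ m<i → subst P (trans (toℕ-inject _) (toℕ-fromℕ< m<i)) (below (fromℕ< m<i))

uniform-bound : ∀ {n} (R : Fin n → ℕ → Set) → (∀ v → ∃ λ N → ∀ {m} → R v m → m < N) →
                ∃ λ N → ∀ v {m} → R v m → m < N
uniform-bound {zero}  R bound = 0 , λ ()
uniform-bound {suc n} R bound with bound zero | uniform-bound (R ∘ suc) (bound ∘ suc)
... | N₀ , b₀ | N , b =
  N₀ + N , λ { zero r → ≤-trans (b₀ r) (m≤m+n N₀ N) ; (suc v) r → ≤-trans (b v r) (m≤n+m N N₀) }

∪-induction : ∀ {n} (P : Subset n → Set) → (∀ S → (∀ v → v ∉ S → P (S ∪ ⁅ v ⁆)) → P S) → ∀ S → P S
∪-induction P inductive-step =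
  All.wfRec ⊃-wellFounded 0ℓ P λ S rec → inductive-step S λ v v∉S → rec (⊂-∪⁅⁆ v∉S)
  where
  ⊂-∪⁅⁆ : ∀ {S v} → v ∉ S → S ⊂ S ∪ ⁅ v ⁆
  ⊂-∪⁅⁆ {S} {v} v∉S = p⊆p∪q ⁅ v ⁆ , v , x∈p∪q⁺ (inj₂ (x∈⁅x⁆ v)) , v∉S

infix 4 _⊆_within_
_⊆_within_ : ∀ {n} → Subset n → Subset n → Subset n → Set
S ⊆ S′ within W = ∀ {x} → x ∈ W → x ∈ S → x ∈ S′

module Play {n} (G : SimpleGraph n) (W : Subset n) where

  legal⇒∉ : ∀ {S v} → Legal G W S v → v ∉ S
  legal⇒∉ {v = v} (v∈W , v∉cl) v∈S =
    v∉cl (v , v , v∈S , v∈S , 0 , (here v∈W , λ _ _ → z≤n) , here v∈W , visits-here refl)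

  legal⇒≢ : ∀ {S v x} → Legal G W S v → x ∈ S → v ≢ x
  legal⇒≢ L x∈S refl = legal⇒∉ L x∈S

  Grundy-unique : ∀ S {g g′} → Grundy G W S g → Grundy G W S g′ → g ≡ g′
  Grundy-unique = ∪-induction _ inductive-step
    where
    inductive-step : ∀ S → (∀ v → v ∉ S → ∀ {g g′} → Grundy G W (S ∪ ⁅ v ⁆) g → Grundy G W (S ∪ ⁅ v ⁆) g′ →
                                          g ≡ g′) →
                     ∀ {g g′} → Grundy G W S g → Grundy G W S g′ → g ≡ g′
    inductive-step S unique d d′ = ≤-antisym (≮⇒≥ (≮ d′ d)) (≮⇒≥ (≮ d d′))
      where
      ≮ : ∀ {g g′} → Grundy G W S g → Grundy G W S g′ → ¬ g < g′
      ≮ (grundy options _) (grundy _ below′) g<g′ with below′ _ g<g′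
      ... | v , L , d with options v L
      ...   | _ , d′ , ≢g = ≢g (unique v (legal⇒∉ L) d′ d)

  Grundy? : ∀ {S g} → Grundy G W S g → ∀ m → Dec (Grundy G W S m)
  Grundy? {S} {g} d m =
    map′ (λ m≡g → subst (Grundy G W S) (sym m≡g) d) (λ d′ → Grundy-unique S d′ d) (m ℕ.≟ g)

  Grundy-exists : ∀ S → ∃ (Grundy G W S)
  Grundy-exists = ∪-induction _ inductive-step
    where
    inductive-step : ∀ S → (∀ v → v ∉ S → ∃ (Grundy G W (S ∪ ⁅ v ⁆))) → ∃ (Grundy G W S)
    inductive-step S value =
      mex-position (least-failure (λ m → any? (option? m)) (λ (v , o) → <-irrefl refl (bounded v o)))
      where
      Option : Fin n → ℕ → Set
      Option v m = Legal G W S v × Grundy G W (S ∪ ⁅ v ⁆) m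
      option? : ∀ m v → Dec (Option v m)
      option? m v with legal? G W S v
      ... | no ¬L = no (¬L ∘ proj₁)
      ... | yes L = map′ (L ,_) proj₂ (Grundy? (proj₂ (value v (legal⇒∉ L))) m)
      option-bound : ∀ v → ∃ λ N → ∀ {m} → Option v m → m < N
      option-bound v with v ∈? S
      ... | yes v∈S = 0 , λ (L , _) → contradiction v∈S (legal⇒∉ L)
      ... | no v∉S  = suc (proj₁ (value v v∉S)) ,
                      λ (_ , d) → s≤s (≤-reflexive (Grundy-unique _ d (proj₂ (value v v∉S))))
      N : ℕ
      N = proj₁ (uniform-bound Option option-bound)
      bounded : ∀ v {m} → Option v m → m < N
      bounded = proj₂ (uniform-bound Option option-bound)
      mex-position : (∃ λ g → ¬ (∃ λ v → Option v g) × (∀ {m} → m < g → ∃ λ v → Option v m)) →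
                     ∃ (Grundy G W S)
      mex-position (g , ¬option , below) = g , grundy options-≢g (λ _ → below)
        where
        options-≢g : ∀ v → Legal G W S v → Σ ℕ λ g′ → Grundy G W (S ∪ ⁅ v ⁆) g′ × g′ ≢ g
        options-≢g v L with value v (legal⇒∉ L)
        ... | g′ , d = g′ , d , λ g′≡g → ¬option (v , L , subst (Grundy G W (S ∪ ⁅ v ⁆)) g′≡g d)

  InClosure-resp : ∀ {S S′ z} → S ⊆ S′ within W → InClosure G W S z → InClosure G W S′ z
  InClosure-resp S⊆S′ (x , y , x∈S , y∈S , d , (w , min) , on) =
    x , y , S⊆S′ (walk-start-∈ w) x∈S , S⊆S′ (walk-end-∈ w) y∈S , d , (w , min) , on

  ∪⁅⁆-resp : ∀ {S S′} v → S ⊆ S′ within W → S ∪ ⁅ v ⁆ ⊆ S′ ∪ ⁅ v ⁆ within W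
  ∪⁅⁆-resp {S} v S⊆S′ x∈W x∈S∪v with x∈p∪q⁻ S ⁅ v ⁆ x∈S∪v
  ... | inj₁ x∈S = x∈p∪q⁺ (inj₁ (S⊆S′ x∈W x∈S))
  ... | inj₂ x≡v = x∈p∪q⁺ (inj₂ x≡v)

  Grundy-resp : ∀ S {S′ g} → S ⊆ S′ within W → S′ ⊆ S within W → Grundy G W S g → Grundy G W S′ g
  Grundy-resp = ∪-induction _ inductive-step
    where
    inductive-step : ∀ S → (∀ v → v ∉ S → ∀ {S′ g} → S ∪ ⁅ v ⁆ ⊆ S′ within W → S′ ⊆ S ∪ ⁅ v ⁆ within W →
                                          Grundy G W (S ∪ ⁅ v ⁆) g → Grundy G W S′ g) →
                     ∀ {S′ g} → S ⊆ S′ within W → S′ ⊆ S within W → Grundy G W S g → Grundy G W S′ g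
    inductive-step S resp {S′} {g} S⊆S′ S′⊆S (grundy options below) = grundy options′ below′
      where
      legal← : ∀ {v} → Legal G W S′ v → Legal G W S v
      legal← (v∈W , v∉cl) = v∈W , v∉cl ∘ InClosure-resp S⊆S′
      legal→ : ∀ {v} → Legal G W S v → Legal G W S′ v
      legal→ (v∈W , v∉cl) = v∈W , v∉cl ∘ InClosure-resp S′⊆S
      move : ∀ {v g′} → Legal G W S v → Grundy G W (S ∪ ⁅ v ⁆) g′ → Grundy G W (S′ ∪ ⁅ v ⁆) g′
      move {v} L = resp v (legal⇒∉ L) (∪⁅⁆-resp v S⊆S′) (∪⁅⁆-resp v S′⊆S)
      options′ : ∀ v → Legal G W S′ v → Σ ℕ λ g′ → Grundy G W (S′ ∪ ⁅ v ⁆) g′ × g′ ≢ g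
      options′ v L′ with options v (legal← L′)
      ... | g′ , d , g′≢g = g′ , move (legal← L′) d , g′≢g
      below′ : ∀ m → m < g → Σ (Fin n) λ v → Legal G W S′ v × Grundy G W (S′ ∪ ⁅ v ⁆) m
      below′ m m<g with below m m<g
      ... | v , L , d = v , legal→ L , move L d

open Play

-- Splitting the game at u

-- c is constant along the edges of G − u, so each class of c is a union of components of G − u.
EdgeConstant : ∀ {n k} → SimpleGraph n → Fin n → (Fin n → Fin k) → Set
EdgeConstant G u c = ∀ {a b} → a ≢ u → b ≢ u → adj G a b ≡ true → c a ≡ c b

componentLabeling⇒edgeConstant : ∀ {n k} {G : SimpleGraph n} {u} {c : Fin n → Fin k} →
                                 IsComponentLabeling G u c → EdgeConstant G u c
componentLabeling⇒edgeConstant {u = u} (labels , _) {a} {b} a≢u b≢u e =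
  proj₂ (labels a b a≢u b≢u) (1 , step (avoid a≢u) e (here (avoid b≢u)))
  where
  avoid : ∀ {x} → x ≢ u → x ∈ ∁ ⁅ u ⁆
  avoid x≢u = x∉p⇒x∈∁p (x≢u ∘ x∈⁅y⁆⇒x≡y u)

module Decomposition {n k} (G : SimpleGraph n) (u : Fin n) (c : Fin n → Fin k)
                     (constant : EdgeConstant G u c) where

  V : Fin k → Subset n
  V = compVerts u c

  ∈compVerts⁺ : ∀ {x i} → x ≡ u ⊎ c x ≡ i → x ∈ V i
  ∈compVerts⁺ {x} {i} h = lookup⇒[]= x (V i) (trans (lookup∘tabulate _ x) (member h))
    where
    member : x ≡ u ⊎ c x ≡ i → does (x ≟ u) ∨ does (c x ≟ i) ≡ true
    member (inj₁ x≡u)  = cong (_∨ _) (dec-true (x ≟ u) x≡u)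
    member (inj₂ cx≡i) = trans (cong (does (x ≟ u) ∨_) (dec-true (c x ≟ i) cx≡i)) (Bool.∨-zeroʳ _)

  ∈compVerts⁻ : ∀ {x i} → x ∈ V i → x ≡ u ⊎ c x ≡ i
  ∈compVerts⁻ {x} {i} x∈V = member (trans (sym (lookup∘tabulate _ x)) ([]=⇒lookup x∈V))
    where
    member : does (x ≟ u) ∨ does (c x ≟ i) ≡ true → x ≡ u ⊎ c x ≡ i
    member with x ≟ u | c x ≟ i
    ... | yes x≡u | _        = λ _ → inj₁ x≡u
    ... | no _    | yes cx≡i = λ _ → inj₂ cx≡i
    ... | no _    | no _     = λ ()

  u∈compVerts : ∀ {i} → u ∈ V i
  u∈compVerts = ∈compVerts⁺ (inj₁ refl)

  class : ∀ {x i} → x ∈ V i → x ≢ u → c x ≡ i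
  class x∈V x≢u = [ (λ x≡u → contradiction x≡u x≢u) , id ]′ (∈compVerts⁻ x∈V)

  edge-within : ∀ {x y i} → x ≢ u → y ≢ u → adj G x y ≡ true → x ∈ V i → y ∈ V i
  edge-within x≢u y≢u e x∈V = ∈compVerts⁺ (inj₂ (trans (sym (constant x≢u y≢u e)) (class x∈V x≢u)))

  leave-through-u : ∀ {i x y l} → x ∈ V i → Walk G ⊤ x y l →
                    Walk G (V i) x y l ⊎ ∃ λ l₁ → ∃ λ l₂ → Walk G (V i) x u l₁ × Walk G ⊤ u y l₂ × l₁ + l₂ ≡ l
  leave-through-u x∈V (here _) = inj₁ (here x∈V)
  leave-through-u {x = x} x∈V w@(step {y = x′} _ e w′) with x ≟ u | x′ ≟ u
  ... | yes refl | _        = inj₂ (0 , _ , here x∈V , w , refl)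
  ... | no _     | yes refl = inj₂ (1 , _ , step x∈V e (here u∈compVerts) , w′ , refl)
  ... | no x≢u   | no x′≢u with leave-through-u (edge-within x≢u x′≢u e x∈V) w′
  ...   | inj₁ w″ = inj₁ (step x∈V e w″)
  ...   | inj₂ (l₁ , l₂ , w₁ , w₂ , l₁+l₂≡l) =
    inj₂ (suc l₁ , l₂ , step x∈V e w₁ , w₂ , cong suc l₁+l₂≡l)

  enter-through-u : ∀ {i x y l} → y ∈ V i → Walk G ⊤ x y l →
                    Walk G (V i) x y l ⊎ ∃ λ l₁ → ∃ λ l₂ → Walk G ⊤ x u l₁ × Walk G (V i) u y l₂ × l₁ + l₂ ≡ l
  enter-through-u y∈V (here _) = inj₁ (here y∈V)
  enter-through-u {i} y∈V (step {x} {x′} x∈⊤ e w) with enter-through-u y∈V w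
  ... | inj₂ (l₁ , l₂ , w₁ , w₂ , l₁+l₂≡l) =
    inj₂ (suc l₁ , l₂ , step x∈⊤ e w₁ , w₂ , cong suc l₁+l₂≡l)
  ... | inj₁ w′ with x ∈? V i
  ...   | yes x∈V = inj₁ (step x∈V e w′)
  ...   | no x∉V with x′ ≟ u
  ...     | yes refl = inj₂ (1 , _ , step x∈⊤ e (here ∈⊤) , w′ , refl)
  ...     | no x′≢u  =
    contradiction (edge-within x′≢u x≢u (trans (SimpleGraph.sym G x′ x) e) (walk-start-∈ w′)) x∉V
    where
    x≢u : x ≢ u
    x≢u x≡u = x∉V (∈compVerts⁺ (inj₁ x≡u))

  shortcut : ∀ {i x y l} → x ∈ V i → y ∈ V i → Walk G ⊤ x y l → ∃ λ l′ → l′ ≤ l × Walk G (V i) x y l′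
  shortcut x∈V y∈V w with enter-through-u y∈V w
  ... | inj₁ w′ = _ , ≤-refl , w′
  ... | inj₂ (l₁ , l₂ , w₁ , w₂ , refl) with leave-through-u x∈V w₁
  ...   | inj₁ w₁′ = _ , ≤-refl , w₁′ ++ʷ w₂
  ...   | inj₂ (m₁ , m₂ , w₁′ , _ , refl) = _ , +-monoˡ-≤ l₂ (m≤m+n m₁ m₂) , w₁′ ++ʷ w₂

  isDist-local⇒global : ∀ {i x y d} → IsDist G (V i) x y d → IsDist G ⊤ x y d
  isDist-local⇒global (w , shortest) = weaken (λ _ → ∈⊤) w , shortest′
    where
    shortest′ : ∀ l → Walk G ⊤ _ _ l → _ ≤ l
    shortest′ l w′ with shortcut (walk-start-∈ w) (walk-end-∈ w) w′
    ... | l′ , l′≤l , w″ = ≤-trans (shortest l′ w″) l′≤l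

  closure-local⇒global : ∀ {i S v} → InClosure G (V i) S v → InClosure G ⊤ S v
  closure-local⇒global (x , y , x∈S , y∈S , d , dist , w , on) =
    x , y , x∈S , y∈S , d , isDist-local⇒global dist , weaken (λ _ → ∈⊤) w , visits-weaken (λ _ → ∈⊤) w on

  closure-global⇒local : ∀ {S v} → u ∈ S → InClosure G ⊤ S v → InClosure G (V (c v)) S v
  closure-global⇒local {S} {v} u∈S (x , y , x∈S , y∈S , _ , (_ , shortest) , w , on) with split-at w on
  ... | la , lb , w₁ , w₂ , refl = geodesic entry exit
    where
    v∈V : v ∈ V (c v)
    v∈V = ∈compVerts⁺ (inj₂ refl)
    Entry Exit : Set
    Entry = ∃ λ x′ → x′ ∈ S × ∃ λ p → ∃ λ q → Walk G ⊤ x x′ p × Walk G (V (c v)) x′ v q × p + q ≡ la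
    Exit  = ∃ λ y′ → y′ ∈ S × ∃ λ q → ∃ λ p → Walk G (V (c v)) v y′ q × Walk G ⊤ y′ y p × q + p ≡ lb
    entry : Entry
    entry with enter-through-u v∈V w₁
    ... | inj₁ w₁′ = x , x∈S , 0 , _ , here ∈⊤ , w₁′ , refl
    ... | inj₂ (p , q , wp , wq , p+q≡) = u , u∈S , p , q , wp , wq , p+q≡
    exit : Exit
    exit with leave-through-u v∈V w₂
    ... | inj₁ w₂′ = y , y∈S , _ , 0 , w₂′ , here ∈⊤ , +-identityʳ _
    ... | inj₂ (q , p , wq , wp , q+p≡) = u , u∈S , q , p , wq , wp , q+p≡
    geodesic : Entry → Exit → InClosure G (V (c v)) S v
    geodesic (x′ , x′∈S , p , q , wp , wq , refl) (y′ , y′∈S , q′ , p′ , wq′ , wp′ , refl) =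
      x′ , y′ , x′∈S , y′∈S , q + q′ , (wq ++ʷ wq′ , shortest′) ,
      wq ++ʷ wq′ , visits-++ʳ wq (visits-first wq′)
      where
      shortest′ : ∀ m → Walk G (V (c v)) x′ y′ m → q + q′ ≤ m
      shortest′ m w′ = +-cancelʳ-≤ p′ _ _ (+-cancelˡ-≤ p _ _ (begin
        p + (q + q′ + p′)   ≡⟨ cong (p +_) (+-assoc q q′ p′) ⟩
        p + (q + (q′ + p′)) ≡⟨ +-assoc p q (q′ + p′) ⟨
        p + q + (q′ + p′)   ≤⟨ shortest _ (wp ++ʷ weaken (λ _ → ∈⊤) w′ ++ʷ wp′) ⟩
        p + (m + p′)        ∎))
        where open ≤-Reasoning

  legal-global⇒local : ∀ {S v} → Legal G ⊤ S v → Legal G (V (c v)) S v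
  legal-global⇒local (_ , v∉cl) = ∈compVerts⁺ (inj₂ refl) , v∉cl ∘ closure-local⇒global

  legal-local⇒global : ∀ {S v i} → u ∈ S → Legal G (V i) S v → Legal G ⊤ S v × c v ≡ i
  legal-local⇒global {S} {v} u∈S L@(v∈V , v∉cl) =
    (∈⊤ , v∉cl ∘ subst (λ j → InClosure G (V j) S v) cv≡i ∘ closure-global⇒local u∈S) , cv≡i
    where
    cv≡i : c v ≡ _
    cv≡i = class v∈V (legal⇒≢ G _ L u∈S)

  ∪⁅⁆⊆-outside : ∀ {S v i} → v ∉ V i → S ∪ ⁅ v ⁆ ⊆ S within V i
  ∪⁅⁆⊆-outside {S} {v} v∉V x∈V x∈S∪v with x∈p∪q⁻ S ⁅ v ⁆ x∈S∪v
  ... | inj₁ x∈S  = x∈S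
  ... | inj₂ x∈⁅v⁆ = contradiction (subst (_∈ V _) (x∈⁅y⁆⇒x≡y v x∈⁅v⁆) x∈V) v∉V

  Grundy-after-move : ∀ {S v j g} gs → v ≢ u → c v ≡ j → Grundy G (V j) (S ∪ ⁅ v ⁆) g →
                      (∀ i → Grundy G (V i) S (gs i)) → ∀ i → Grundy G (V i) (S ∪ ⁅ v ⁆) ((gs [ j ]≔ g) i)
  Grundy-after-move {S} {v} {j} gs v≢u cv≡j dⱼ ds i with i ≟ j
  ... | yes refl = subst (Grundy G (V i) (S ∪ ⁅ v ⁆)) (sym (updateAt-updates i gs)) dⱼ
  ... | no i≢j   = subst (Grundy G (V i) (S ∪ ⁅ v ⁆)) (sym (updateAt-minimal i j gs i≢j))
                     (Grundy-resp G (V i) S (λ _ → p⊆p∪q ⁅ v ⁆) (∪⁅⁆⊆-outside v∉V) (ds i))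
    where
    v∉V : v ∉ V i
    v∉V v∈V = i≢j (trans (sym (class v∈V v≢u)) cv≡j)

  Grundy-bigXor : ∀ S → u ∈ S → ∀ gs → (∀ i → Grundy G (V i) S (gs i)) → Grundy G ⊤ S (bigXor gs)
  Grundy-bigXor = ∪-induction _ inductive-step
    where
    inductive-step : ∀ S → (∀ v → v ∉ S → u ∈ S ∪ ⁅ v ⁆ → ∀ gs → (∀ i → Grundy G (V i) (S ∪ ⁅ v ⁆) (gs i)) →
                                         Grundy G ⊤ (S ∪ ⁅ v ⁆) (bigXor gs)) →
                     u ∈ S → ∀ gs → (∀ i → Grundy G (V i) S (gs i)) → Grundy G ⊤ S (bigXor gs)
    inductive-step S sum u∈S gs ds = grundy options below
      where
      after : ∀ {v j g} → Legal G ⊤ S v → c v ≡ j → Grundy G (V j) (S ∪ ⁅ v ⁆) g →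
              Grundy G ⊤ (S ∪ ⁅ v ⁆) (bigXor (gs [ j ]≔ g))
      after L cv≡j dⱼ =
        sum _ (legal⇒∉ G ⊤ L) (x∈p∪q⁺ (inj₁ u∈S)) _ (Grundy-after-move gs (legal⇒≢ G ⊤ L u∈S) cv≡j dⱼ ds)
      options : ∀ v → Legal G ⊤ S v → Σ ℕ λ g → Grundy G ⊤ (S ∪ ⁅ v ⁆) g × g ≢ bigXor gs
      options v L with ds (c v)
      ... | grundy optionsᶜ _ with optionsᶜ v (legal-global⇒local L)
      ...   | g , d , g≢ = _ , after L refl d , g≢ ∘ bigXor-update-cancel gs (c v) g
      below : ∀ m → m < bigXor gs → Σ (Fin n) λ v → Legal G ⊤ S v × Grundy G ⊤ (S ∪ ⁅ v ⁆) m
      below m m<⊕ with bigXor-decrease gs m m<⊕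
      ... | j , g , g<gⱼ , ⊕≡m with ds j
      ...   | grundy _ belowʲ with belowʲ g g<gⱼ
      ...     | v , L , d with legal-local⇒global u∈S L
      ...       | L′ , cv≡j = v , L′ , subst (Grundy G ⊤ (S ∪ ⁅ v ⁆)) ⊕≡m (after L′ cv≡j d)

lemma2 : ∀ {n k} (G : SimpleGraph n) (u : Fin n) → Connected G → Articulation G u →
           (c : Fin n → Fin k) → IsComponentLabeling G u c →
           (Σ (Fin k → ℕ) λ gs →
              (∀ i → Grundy G (compVerts u c i) ⁅ u ⁆ (gs i)) ×
              Grundy G ⊤ ⁅ u ⁆ (bigXor gs)) ×
           (∀ (g : ℕ) (gs : Fin k → ℕ) → Grundy G ⊤ ⁅ u ⁆ g →
              (∀ i → Grundy G (compVerts u c i) ⁅ u ⁆ (gs i)) → g ≡ bigXor gs)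
lemma2 G u _ _ c labelling =
  (gs , ds , Grundy-bigXor ⁅ u ⁆ (x∈⁅x⁆ u) gs ds) ,
  λ g gs′ d ds′ → Grundy-unique G ⊤ ⁅ u ⁆ d (Grundy-bigXor ⁅ u ⁆ (x∈⁅x⁆ u) gs′ ds′)
  where
  open Decomposition G u c (componentLabeling⇒edgeConstant labelling)
  gs : Fin _ → ℕ
  gs i = proj₁ (Grundy-exists G (V i) ⁅ u ⁆)
  ds : ∀ i → Grundy G (V i) ⁅ u ⁆ (gs i)
  ds i = proj₂ (Grundy-exists G (V i) ⁅ u ⁆)
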